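{- Let $k\ge1$ and let $t_1,\dots,t_k$ be given, with $t_n=0$ for $n>k$. Let $F$, $G$, $\mathcal{E}(G)$, $C(G)$ and $S(G)$ be as in the context. Then for every $n\ge1$, $$C(G)_n=\tfrac12\left(F_n-t_n\right),\qquad S(G)_n=\tfrac12\left(F_n+t_n\right).$$
   Context: Sequences are indexed by $n\ge0$; their convolution product is $(a\ast b)_n=\sum_{j=0}^n a_{n-j}b_j$, with identity $\delta=(1,0,0,\dots)$; $\overline{a}$ denotes the convolution inverse of $a$ (it exists when $a_0$ is invertible). $F$ is the generalized Fibonacci sequence: $F_0=1$, $F_n=\sum_{j=1}^k t_jF_{n-j}$ ($F_m=0$ for $m<0$). $G$ is the generalized Lucas sequence: $G_n=\sum_{\alpha}\frac{n}{|\alpha|}\binom{|\alpha|}{\alpha_1,\dots,\alpha_k}t_1^{\alpha_1}\cdots t_k^{\alpha_k}$ for $n\ge1$, summing over $\alpha\in\mathbb{Z}_{\ge0}^k$ with $\sum_j j\alpha_j=n$. The isobaric exponential of $G$ is the sequence $\mathcal{E}(G)$ with $\mathcal{E}(G)_0=1$ and $\mathcal{E}(G)_n=\frac1n\left(F_{n-1}G_1+F_{n-2}G_2+\cdots+F_1G_{n-1}+G_n\right)$ for $n\ge1$. The isocosine and isosine of $G$ are $C(G)=\frac12(\mathcal{E}(G)+\overline{\mathcal{E}(G)})$ and $S(G)=\frac12(\mathcal{E}(G)-\overline{\mathcal{E}(G)})$. -}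

module Defs where

open import Data.Nat as ℕ using (ℕ; zero; suc; _!; NonZero)
open import Data.Nat.Properties using (_!≢0)
open import Data.Integer using (+_)
open import Data.Rational as ℚ using (ℚ; 0ℚ; 1ℚ; ½; _+_; _*_; _-_; _/_)
open import Data.Fin using (Fin)
open import Data.Vec as Vec using (Vec; []; _∷_; lookup)
open import Data.List as List using (List; []; _∷_)
open import Relation.Binary.PropositionalEquality using (_≡_)

Seq : Set
Seq = ℕ → ℚ

ι : ℕ → ℚ
ι n = + n / 1

Σ≤ : ℕ → (ℕ → ℚ) → ℚ
Σ≤ zero    f = f 0
Σ≤ (suc n) f = Σ≤ n f + f (suc n)

Σ1≤ : ℕ → (ℕ → ℚ) → ℚ
Σ1≤ zero    f = 0ℚ
Σ1≤ (suc n) f = Σ1≤ n f + f (suc n)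

_⊛_ : Seq → Seq → Seq
(a ⊛ b) n = Σ≤ n (λ j → a (n ℕ.∸ j) * b j)

δ : Seq
δ zero    = 1ℚ
δ (suc _) = 0ℚ

IsConvInverse : Seq → Seq → Set
IsConvInverse a b = ∀ n → (a ⊛ b) n ≡ δ n

-- Coefficients t_n extended by t_0 = 0 (unused) and t_n = 0 for n > k;
-- t : Vec ℚ k lists t_1, ..., t_k.
tc : {k : ℕ} → Vec ℚ k → ℕ → ℚ
tc t zero = 0ℚ
tc [] (suc n) = 0ℚ
tc (x ∷ t) (suc zero) = x
tc (x ∷ t) (suc (suc n)) = tc t (suc n)

nth : List ℚ → ℕ → ℚ
nth [] _ = 0ℚ
nth (x ∷ xs) zero = x
nth (x ∷ xs) (suc j) = nth xs j

-- Fhist t n = [F_n, F_{n-1}, ..., F_0]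
Fhist : {k : ℕ} → Vec ℚ k → ℕ → List ℚ
Fhist t zero = 1ℚ ∷ []
Fhist {k} t (suc n) =
  Σ1≤ k (λ j → tc t j * nth (Fhist t n) (j ℕ.∸ 1)) ∷ Fhist t n

-- Generalized Fibonacci: F_0 = 1, F_n = Σ_{j=1}^k t_j F_{n-j}, F_m = 0 (m<0)
F : {k : ℕ} → Vec ℚ k → Seq
F t n = nth (Fhist t n) 0

boxes : (k m : ℕ) → List (Vec ℕ k)
boxes zero m = Vec.[] ∷ []
boxes (suc k) m =
  List.concatMap (λ a → List.map (a Vec.∷_) (boxes k m)) (List.upTo (suc m))

weight : {k : ℕ} → Vec ℕ k → ℕ
weight α = Vec.sum (Vec.zipWith ℕ._*_ (Vec.tabulate (λ i → suc (Data.Fin.toℕ i))) α)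

∣_∣ᵥ : {k : ℕ} → Vec ℕ k → ℕ
∣ α ∣ᵥ = Vec.sum α

_^ℚ_ : ℚ → ℕ → ℚ
x ^ℚ zero = 1ℚ
x ^ℚ suc e = x * (x ^ℚ e)

multinomial : {k : ℕ} → Vec ℕ k → ℚ
multinomial α =
  ι (∣ α ∣ᵥ !) * Vec.foldr _ (λ a r → (+ 1 / (a !)) {{a !≢0}} * r) 1ℚ α

tpow : {k : ℕ} → Vec ℚ k → Vec ℕ k → ℚ
tpow t α = Vec.foldr _ _*_ 1ℚ (Vec.zipWith _^ℚ_ t α)

-- n / |α|  (only used when |α| ≥ 1; set to 0 if |α| = 0)
ratio : ℕ → ℕ → ℚ
ratio n zero = 0ℚ
ratio n (suc m) = + n / suc m

sumℚ : List ℚ → ℚ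
sumℚ = List.foldr _+_ 0ℚ

-- Generalized Lucas sequence, n ≥ 1:
-- G_n = Σ_{α ∈ ℕ^k, Σ j α_j = n} (n/|α|) (|α| choose α) t^α.
-- (Every such α has α_j ≤ n, so enumerating boxes k n is exhaustive.)
-- G_0 is not used; set to 0.
G : {k : ℕ} → Vec ℚ k → Seq
G t zero = 0ℚ
G {k} t (suc n') =
  sumℚ (List.map term (List.filter (λ α → weight α ℕ.≟ n) (boxes k n)))
  where
  n = suc n'
  term : Vec ℕ k → ℚ
  term α = ratio n ∣ α ∣ᵥ * multinomial α * tpow t α

-- Isobaric exponential: E_0 = 1,
-- E_n = (1/n)(F_{n-1}G_1 + ... + F_1 G_{n-1} + G_n)  (note F_0 = 1)
isoExp : {k : ℕ} → Vec ℚ k → Seq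
isoExp t zero = 1ℚ
isoExp t (suc n') =
  (+ 1 / suc n') * Σ1≤ (suc n') (λ i → F t (suc n' ℕ.∸ i) * G t i)

isoCos : Seq → Seq → Seq
isoCos E Ē n = ½ * (E n + Ē n)

isoSin : Seq → Seq → Seq
isoSin E Ē n = ½ * (E n - Ē n)

-- The recurrence for F says F = δ + F ∗ τ with τ = (0, t₁, …, t_k, 0, …), hence
-- F ∗ (δ − τ) = δ.  The map (∂a)ₙ = n aₙ is a derivation of ∗, so ∂F = ∂F ∗ τ + F ∗ ∂τ;
-- as τ₀ = 0 this equation has a unique solution, namely F ∗ (F ∗ ∂τ).
-- On the other hand Fₙ = Σ_{weight α = n} (|α| choose α) t^α.  Since
-- |α| (|α| − 1 choose α − eⱼ) = αⱼ (|α| choose α) and weight α = Σⱼ j αⱼ, the summand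
-- (n / |α|) (|α| choose α) t^α of Gₙ equals Σⱼ j tⱼ (|α| − 1 choose α − eⱼ) t^(α − eⱼ),
-- and summing over α gives G = F ∗ ∂τ.  Therefore n Fₙ = (F ∗ G)ₙ, i.e. 𝓔(G) = F, whose
-- inverse is δ − τ; the formulas for C(G) and S(G) follow as (δ − τ)ₙ = −tₙ for n ≥ 1.

module Submission where

open import Defs
open import Level using (0ℓ)
open import Data.Nat as ℕ using (ℕ; zero; suc; _≤_; _<_; z≤n; s≤s; _!)
import Data.Nat.Properties as ℕP
import Data.Nat.Tactic.RingSolver as ℕSolver
open import Data.Nat.Properties using (_!≢0)
open import Data.Nat.Induction using (<-rec)
open import Data.Integer as ℤ using (+_)
import Data.Integer.Properties as ℤP
import Data.Integer.Tactic.RingSolver as ℤSolver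
open import Data.Rational as ℚ using (ℚ; 0ℚ; 1ℚ; ½; _+_; _*_; _-_; -_; _/_; toℚᵘ)
import Data.Rational.Properties as ℚP
import Data.Rational.Unnormalised as ℚᵘ
import Data.Rational.Unnormalised.Properties as ℚᵘP
open import Data.Fin using (Fin; zero; suc; toℕ)
open import Data.Vec as V using (Vec; []; _∷_; lookup)
open import Data.Vec.Relation.Unary.All as All using (All; []; _∷_)
open import Data.List as L using (List)
open import Data.Product using (Σ; _×_; _,_; proj₂)
open import Function using (_∘_)
open import Relation.Nullary using (Dec; yes; no; ¬_; contradiction)
open import Relation.Nullary.Decidable using (dec⇒maybe)
open import Relation.Binary.PropositionalEquality using (_≡_; _≢_; _≗_; refl; sym; trans; cong; cong₂; module ≡-Reasoning)
open import Algebra.Bundles using (CommutativeRing)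
open import Algebra.Properties.Semiring.Sum (CommutativeRing.semiring ℚP.+-*-commutativeRing)
  using (sum; sum-syntax; sum-cong-≗; *-distribˡ-sum; *-distribʳ-sum)
open import Tactic.RingSolver using (solve-∀)
open import Tactic.RingSolver.Core.AlmostCommutativeRing using (AlmostCommutativeRing; fromCommutativeRing)

-- Rational arithmetic

ℚ-ring : AlmostCommutativeRing 0ℓ 0ℓ
ℚ-ring = fromCommutativeRing ℚP.+-*-commutativeRing (λ x → dec⇒maybe (0ℚ ℚ.≟ x))

module _ where
  open ℚᵘP.≃-Reasoning

  toℚᵘ-/ : ∀ n m → toℚᵘ (+ n / suc m) ℚᵘ.≃ ℚᵘ.mkℚᵘ (+ n) m
  toℚᵘ-/ n m = ℚP.toℚᵘ-fromℚᵘ (ℚᵘ.mkℚᵘ (+ n) m)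

  ι-+ : ∀ m n → ι (m ℕ.+ n) ≡ ι m + ι n
  ι-+ m n = ℚP.toℚᵘ-injective (begin
    toℚᵘ (ι (m ℕ.+ n))                    ≈⟨ toℚᵘ-/ (m ℕ.+ n) 0 ⟩
    ℚᵘ.mkℚᵘ (+ (m ℕ.+ n)) 0               ≈⟨ ℚᵘ.*≡* (trans (cong (ℤ._* + 1) (ℤP.pos-+ m n)) (cross-multiply (+ m) (+ n))) ⟩
    ℚᵘ.mkℚᵘ (+ m) 0 ℚᵘ.+ ℚᵘ.mkℚᵘ (+ n) 0  ≈⟨ ℚᵘP.+-cong (toℚᵘ-/ m 0) (toℚᵘ-/ n 0) ⟨
    toℚᵘ (ι m) ℚᵘ.+ toℚᵘ (ι n)            ≈⟨ ℚP.toℚᵘ-homo-+ (ι m) (ι n) ⟨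
    toℚᵘ (ι m + ι n)                      ∎)
    where
    cross-multiply : ∀ a b → (a ℤ.+ b) ℤ.* + 1 ≡ (a ℤ.* + 1 ℤ.+ b ℤ.* + 1) ℤ.* + 1
    cross-multiply = ℤSolver.solve-∀

  ι-* : ∀ m n → ι (m ℕ.* n) ≡ ι m * ι n
  ι-* m n = ℚP.toℚᵘ-injective (begin
    toℚᵘ (ι (m ℕ.* n))                    ≈⟨ toℚᵘ-/ (m ℕ.* n) 0 ⟩
    ℚᵘ.mkℚᵘ (+ (m ℕ.* n)) 0               ≈⟨ ℚᵘ.*≡* (cong (ℤ._* + 1) (ℤP.pos-* m n)) ⟩
    ℚᵘ.mkℚᵘ (+ m) 0 ℚᵘ.* ℚᵘ.mkℚᵘ (+ n) 0  ≈⟨ ℚᵘP.*-cong (toℚᵘ-/ m 0) (toℚᵘ-/ n 0) ⟨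
    toℚᵘ (ι m) ℚᵘ.* toℚᵘ (ι n)            ≈⟨ ℚP.toℚᵘ-homo-* (ι m) (ι n) ⟨
    toℚᵘ (ι m * ι n)                      ∎)

  1/n*ι[n]≡1 : ∀ m → (+ 1 / suc m) * ι (suc m) ≡ 1ℚ
  1/n*ι[n]≡1 m = ℚP.toℚᵘ-injective (begin
    toℚᵘ ((+ 1 / suc m) * ι (suc m))               ≈⟨ ℚP.toℚᵘ-homo-* (+ 1 / suc m) (ι (suc m)) ⟩
    toℚᵘ (+ 1 / suc m) ℚᵘ.* toℚᵘ (ι (suc m))       ≈⟨ ℚᵘP.*-cong (toℚᵘ-/ 1 m) (toℚᵘ-/ (suc m) 0) ⟩
    ℚᵘ.mkℚᵘ (+ 1) m ℚᵘ.* ℚᵘ.mkℚᵘ (+ suc m) 0       ≈⟨ ℚᵘ.*≡* (cross-multiply (+ suc m)) ⟩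
    toℚᵘ 1ℚ                                        ∎)
    where
    cross-multiply : ∀ a → (+ 1 ℤ.* a) ℤ.* + 1 ≡ + 1 ℤ.* (a ℤ.* + 1)
    cross-multiply = ℤSolver.solve-∀

  n/d≡ι[n]*1/d : ∀ n m → + n / suc m ≡ ι n * (+ 1 / suc m)
  n/d≡ι[n]*1/d n m = ℚP.toℚᵘ-injective (begin
    toℚᵘ (+ n / suc m)                        ≈⟨ toℚᵘ-/ n m ⟩
    ℚᵘ.mkℚᵘ (+ n) m                           ≈⟨ ℚᵘ.*≡* (cross-multiply (+ n) (+ suc m)) ⟩
    ℚᵘ.mkℚᵘ (+ n) 0 ℚᵘ.* ℚᵘ.mkℚᵘ (+ 1) m      ≈⟨ ℚᵘP.*-cong (toℚᵘ-/ n 0) (toℚᵘ-/ 1 m) ⟨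
    toℚᵘ (ι n) ℚᵘ.* toℚᵘ (+ 1 / suc m)        ≈⟨ ℚP.toℚᵘ-homo-* (ι n) (+ 1 / suc m) ⟨
    toℚᵘ (ι n * (+ 1 / suc m))                ∎)
    where
    cross-multiply : ∀ a d → a ℤ.* (+ 1 ℤ.* d) ≡ (a ℤ.* + 1) ℤ.* d
    cross-multiply = ℤSolver.solve-∀

  ι[m]*1/[m*n]≡1/n : ∀ m n .{{_ : ℕ.NonZero n}} →
    ι (suc m) * (+ 1 / (suc m ℕ.* n)) {{ℕP.m*n≢0 (suc m) n}} ≡ + 1 / n
  ι[m]*1/[m*n]≡1/n m (suc n) = ℚP.toℚᵘ-injective (begin
    toℚᵘ (ι (suc m) * (+ 1 / (suc m ℕ.* suc n)))                    ≈⟨ ℚP.toℚᵘ-homo-* (ι (suc m)) _ ⟩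
    toℚᵘ (ι (suc m)) ℚᵘ.* toℚᵘ (+ 1 / (suc m ℕ.* suc n))            ≈⟨ ℚᵘP.*-cong (toℚᵘ-/ (suc m) 0) (toℚᵘ-/ 1 (n ℕ.+ m ℕ.* suc n)) ⟩
    ℚᵘ.mkℚᵘ (+ suc m) 0 ℚᵘ.* ℚᵘ.mkℚᵘ (+ 1) (n ℕ.+ m ℕ.* suc n)     ≈⟨ ℚᵘ.*≡* (trans (cross-multiply (+ suc m) (+ suc n)) (cong (λ z → + 1 ℤ.* (+ 1 ℤ.* z)) (sym (ℤP.pos-* (suc m) (suc n))))) ⟩
    ℚᵘ.mkℚᵘ (+ 1) n                                                ≈⟨ toℚᵘ-/ 1 n ⟨
    toℚᵘ (+ 1 / suc n)                                             ∎)
    where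
    cross-multiply : ∀ a b → (a ℤ.* + 1) ℤ.* b ≡ + 1 ℤ.* (+ 1 ℤ.* (a ℤ.* b))
    cross-multiply = ℤSolver.solve-∀

ι[1+n]*1/[1+n]!≡1/n! : ∀ n → ι (suc n) * (+ 1 / (suc n !)) {{suc n !≢0}} ≡ (+ 1 / (n !)) {{n !≢0}}
ι[1+n]*1/[1+n]!≡1/n! n = ι[m]*1/[m*n]≡1/n n (n !) {{n !≢0}}

open ≡-Reasoning

*-cancelʳ-ι : ∀ x y m → x * ι (suc m) ≡ y * ι (suc m) → x ≡ y
*-cancelʳ-ι x y m eq = begin
  x            ≡⟨ ℚP.*-identityʳ x ⟨
  x * 1ℚ       ≡⟨ cong (x *_) (1/n*ι[n]≡1 m) ⟨
  x * (r * c)  ≡⟨ swap x r c ⟩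
  x * c * r    ≡⟨ cong (_* r) eq ⟩
  y * c * r    ≡⟨ swap y r c ⟨
  y * (r * c)  ≡⟨ cong (y *_) (1/n*ι[n]≡1 m) ⟩
  y * 1ℚ       ≡⟨ ℚP.*-identityʳ y ⟩
  y            ∎
  where
  c r : ℚ
  c = ι (suc m)
  r = + 1 / suc m
  swap : ∀ x r c → x * (r * c) ≡ x * c * r
  swap = solve-∀ ℚ-ring

-- Finite sums and convolution

Σ≤-cong : ∀ n {f g : ℕ → ℚ} → (∀ j → j ≤ n → f j ≡ g j) → Σ≤ n f ≡ Σ≤ n g
Σ≤-cong zero    f≡g = f≡g 0 z≤n
Σ≤-cong (suc n) f≡g = cong₂ _+_ (Σ≤-cong n (λ j j≤n → f≡g j (ℕP.m≤n⇒m≤1+n j≤n))) (f≡g (suc n) ℕP.≤-refl)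

Σ≤-zero : ∀ n {f : ℕ → ℚ} → (∀ j → j ≤ n → f j ≡ 0ℚ) → Σ≤ n f ≡ 0ℚ
Σ≤-zero zero    f≡0 = f≡0 0 z≤n
Σ≤-zero (suc n) f≡0 = trans (cong₂ _+_ (Σ≤-zero n (λ j j≤n → f≡0 j (ℕP.m≤n⇒m≤1+n j≤n))) (f≡0 (suc n) ℕP.≤-refl)) (ℚP.+-identityˡ 0ℚ)

Σ≤-distrib-+ : ∀ n (f g : ℕ → ℚ) → Σ≤ n (λ j → f j + g j) ≡ Σ≤ n f + Σ≤ n g
Σ≤-distrib-+ zero    f g = refl
Σ≤-distrib-+ (suc n) f g = trans (cong (_+ (f (suc n) + g (suc n))) (Σ≤-distrib-+ n f g)) (interchange (Σ≤ n f) (Σ≤ n g) (f (suc n)) (g (suc n)))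
  where
  interchange : ∀ a b c d → (a + b) + (c + d) ≡ (a + c) + (b + d)
  interchange = solve-∀ ℚ-ring

Σ≤-neg : ∀ n (f : ℕ → ℚ) → Σ≤ n (λ j → - f j) ≡ - Σ≤ n f
Σ≤-neg zero    f = refl
Σ≤-neg (suc n) f = trans (cong (_+ - f (suc n)) (Σ≤-neg n f)) (sym (ℚP.neg-distrib-+ (Σ≤ n f) (f (suc n))))

*-distribˡ-Σ≤ : ∀ n c (f : ℕ → ℚ) → c * Σ≤ n f ≡ Σ≤ n (λ j → c * f j)
*-distribˡ-Σ≤ zero    c f = refl
*-distribˡ-Σ≤ (suc n) c f = trans (ℚP.*-distribˡ-+ c (Σ≤ n f) (f (suc n))) (cong (_+ c * f (suc n)) (*-distribˡ-Σ≤ n c f))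

*-distribʳ-Σ≤ : ∀ n c (f : ℕ → ℚ) → Σ≤ n f * c ≡ Σ≤ n (λ j → f j * c)
*-distribʳ-Σ≤ n c f = trans (ℚP.*-comm (Σ≤ n f) c) (trans (*-distribˡ-Σ≤ n c f) (Σ≤-cong n (λ j _ → ℚP.*-comm c (f j))))

Σ≤-head : ∀ n (f : ℕ → ℚ) → Σ≤ (suc n) f ≡ f 0 + Σ≤ n (λ j → f (suc j))
Σ≤-head zero    f = refl
Σ≤-head (suc n) f = trans (cong (_+ f (suc (suc n))) (Σ≤-head n f)) (ℚP.+-assoc (f 0) _ _)

Σ≤≡head+Σ1≤ : ∀ n (f : ℕ → ℚ) → Σ≤ n f ≡ f 0 + Σ1≤ n f
Σ≤≡head+Σ1≤ zero    f = sym (ℚP.+-identityʳ (f 0))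
Σ≤≡head+Σ1≤ (suc n) f = trans (cong (_+ f (suc n)) (Σ≤≡head+Σ1≤ n f)) (ℚP.+-assoc (f 0) _ _)

Σ1≤-zero : ∀ n {f : ℕ → ℚ} → (∀ j → f (suc j) ≡ 0ℚ) → Σ1≤ n f ≡ 0ℚ
Σ1≤-zero zero    f≡0 = refl
Σ1≤-zero (suc n) f≡0 = trans (cong₂ _+_ (Σ1≤-zero n f≡0) (f≡0 n)) (ℚP.+-identityˡ 0ℚ)

Σ≤-reverse : ∀ n (f : ℕ → ℚ) → Σ≤ n f ≡ Σ≤ n (λ j → f (n ℕ.∸ j))
Σ≤-reverse zero    f = refl
Σ≤-reverse (suc n) f = begin
  Σ≤ n f + f (suc n)                          ≡⟨ cong (_+ f (suc n)) (Σ≤-reverse n f) ⟩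
  Σ≤ n (λ j → f (n ℕ.∸ j)) + f (suc n)        ≡⟨ ℚP.+-comm _ (f (suc n)) ⟩
  f (suc n) + Σ≤ n (λ j → f (suc n ℕ.∸ suc j)) ≡⟨ Σ≤-head n (λ j → f (suc n ℕ.∸ j)) ⟨
  Σ≤ (suc n) (λ j → f (suc n ℕ.∸ j))           ∎

Σ≤-extend : ∀ n d {f : ℕ → ℚ} → (∀ j → n < j → f j ≡ 0ℚ) → Σ≤ (n ℕ.+ d) f ≡ Σ≤ n f
Σ≤-extend n zero    {f} f≡0 = cong (λ m → Σ≤ m f) (ℕP.+-identityʳ n)
Σ≤-extend n (suc d) {f} f≡0 = begin
  Σ≤ (n ℕ.+ suc d) f                 ≡⟨ cong (λ m → Σ≤ m f) (ℕP.+-suc n d) ⟩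
  Σ≤ (n ℕ.+ d) f + f (suc (n ℕ.+ d)) ≡⟨ cong₂ _+_ (Σ≤-extend n d f≡0) (f≡0 _ (s≤s (ℕP.m≤m+n n d))) ⟩
  Σ≤ n f + 0ℚ                        ≡⟨ ℚP.+-identityʳ _ ⟩
  Σ≤ n f                             ∎

Σ≤-triangle : ∀ n (f : ℕ → ℕ → ℚ) →
  Σ≤ n (λ j → Σ≤ j (λ i → f j i)) ≡ Σ≤ n (λ i → Σ≤ (n ℕ.∸ i) (λ l → f (i ℕ.+ l) i))
Σ≤-triangle zero    f = refl
Σ≤-triangle (suc n) f = begin
  Σ≤ n (λ j → Σ≤ j (λ i → f j i)) + (Σ≤ n (λ i → f (suc n) i) + f (suc n) (suc n))
    ≡⟨ cong (_+ (Σ≤ n (λ i → f (suc n) i) + f (suc n) (suc n))) (Σ≤-triangle n f) ⟩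
  rows n + (Σ≤ n (λ i → f (suc n) i) + f (suc n) (suc n))
    ≡⟨ ℚP.+-assoc (rows n) _ _ ⟨
  (rows n + Σ≤ n (λ i → f (suc n) i)) + f (suc n) (suc n)
    ≡⟨ cong₂ _+_ (sym (Σ≤-distrib-+ n _ _)) (cong (λ m → f m (suc n)) (sym (ℕP.+-identityʳ (suc n)))) ⟩
  Σ≤ n (λ i → Σ≤ (n ℕ.∸ i) (λ l → f (i ℕ.+ l) i) + f (suc n) i) + f (suc n ℕ.+ 0) (suc n)
    ≡⟨ cong₂ _+_ (Σ≤-cong n extend-row) (cong (λ m → Σ≤ m (λ l → f (suc n ℕ.+ l) (suc n))) (sym (ℕP.n∸n≡0 n))) ⟩
  rows (suc n) ∎
  where
  rows : ℕ → ℚ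
  rows m = Σ≤ m (λ i → Σ≤ (m ℕ.∸ i) (λ l → f (i ℕ.+ l) i))
  extend-row : ∀ i → i ≤ n → Σ≤ (n ℕ.∸ i) (λ l → f (i ℕ.+ l) i) + f (suc n) i ≡ Σ≤ (suc n ℕ.∸ i) (λ l → f (i ℕ.+ l) i)
  extend-row i i≤n rewrite ℕP.+-∸-assoc 1 i≤n =
    cong (λ m → Σ≤ (n ℕ.∸ i) (λ l → f (i ℕ.+ l) i) + f m i)
      (trans (sym (ℕP.m+[n∸m]≡n (ℕP.m≤n⇒m≤1+n i≤n))) (cong (i ℕ.+_) (ℕP.+-∸-assoc 1 i≤n)))

∂ : Seq → Seq
∂ a n = ι n * a n

⊛-congˡ : ∀ {a b : Seq} c → a ≗ b → a ⊛ c ≗ b ⊛ c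
⊛-congˡ c a≗b n = Σ≤-cong n (λ j _ → cong (_* c j) (a≗b (n ℕ.∸ j)))

⊛-congʳ : ∀ (a : Seq) {b c} → b ≗ c → a ⊛ b ≗ a ⊛ c
⊛-congʳ a b≗c n = Σ≤-cong n (λ j _ → cong (a (n ℕ.∸ j) *_) (b≗c j))

⊛-comm : ∀ (a b : Seq) → a ⊛ b ≗ b ⊛ a
⊛-comm a b n = trans (Σ≤-reverse n _) (Σ≤-cong n (λ j j≤n →
  trans (cong (λ m → a m * b (n ℕ.∸ j)) (ℕP.m∸[m∸n]≡n j≤n)) (ℚP.*-comm (a j) (b (n ℕ.∸ j)))))

⊛-assoc : ∀ (a b c : Seq) → (a ⊛ b) ⊛ c ≗ a ⊛ (b ⊛ c)
⊛-assoc a b c n = begin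
  Σ≤ n (λ i → Σ≤ (n ℕ.∸ i) (λ l → a (n ℕ.∸ i ℕ.∸ l) * b l) * c i)
    ≡⟨ Σ≤-cong n (λ i _ → *-distribʳ-Σ≤ (n ℕ.∸ i) (c i) _) ⟩
  Σ≤ n (λ i → Σ≤ (n ℕ.∸ i) (λ l → a (n ℕ.∸ i ℕ.∸ l) * b l * c i))
    ≡⟨ Σ≤-cong n (λ i _ → Σ≤-cong (n ℕ.∸ i) (λ l _ → reindex i l)) ⟩
  Σ≤ n (λ i → Σ≤ (n ℕ.∸ i) (λ l → a (n ℕ.∸ (i ℕ.+ l)) * (b ((i ℕ.+ l) ℕ.∸ i) * c i)))
    ≡⟨ Σ≤-triangle n (λ j i → a (n ℕ.∸ j) * (b (j ℕ.∸ i) * c i)) ⟨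
  Σ≤ n (λ j → Σ≤ j (λ i → a (n ℕ.∸ j) * (b (j ℕ.∸ i) * c i)))
    ≡⟨ Σ≤-cong n (λ j _ → *-distribˡ-Σ≤ j (a (n ℕ.∸ j)) _) ⟨
  Σ≤ n (λ j → a (n ℕ.∸ j) * Σ≤ j (λ i → b (j ℕ.∸ i) * c i)) ∎
  where
  reindex : ∀ i l → a (n ℕ.∸ i ℕ.∸ l) * b l * c i ≡ a (n ℕ.∸ (i ℕ.+ l)) * (b ((i ℕ.+ l) ℕ.∸ i) * c i)
  reindex i l rewrite ℕP.∸-+-assoc n i l | ℕP.m+n∸m≡n i l = ℚP.*-assoc (a (n ℕ.∸ (i ℕ.+ l))) (b l) (c i)

⊛-distribˡ-+ : ∀ (a b c : Seq) → a ⊛ (λ m → b m + c m) ≗ λ n → (a ⊛ b) n + (a ⊛ c) n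
⊛-distribˡ-+ a b c n = trans (Σ≤-cong n (λ j _ → ℚP.*-distribˡ-+ (a (n ℕ.∸ j)) (b j) (c j))) (Σ≤-distrib-+ n _ _)

⊛-negʳ : ∀ (a b : Seq) → a ⊛ (λ m → - b m) ≗ λ n → - (a ⊛ b) n
⊛-negʳ a b n = trans (Σ≤-cong n (λ j _ → sym (ℚP.neg-distribʳ-* (a (n ℕ.∸ j)) (b j)))) (Σ≤-neg n _)

⊛-identityʳ : ∀ (a : Seq) → a ⊛ δ ≗ a
⊛-identityʳ a zero    = ℚP.*-identityʳ (a 0)
⊛-identityʳ a (suc n) = begin
  Σ≤ (suc n) (λ j → a (suc n ℕ.∸ j) * δ j)                ≡⟨ Σ≤-head n _ ⟩
  a (suc n) * 1ℚ + Σ≤ n (λ j → a (n ℕ.∸ j) * 0ℚ)          ≡⟨ cong₂ _+_ (ℚP.*-identityʳ (a (suc n))) (Σ≤-zero n (λ j _ → ℚP.*-zeroʳ (a (n ℕ.∸ j)))) ⟩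
  a (suc n) + 0ℚ                                        ≡⟨ ℚP.+-identityʳ (a (suc n)) ⟩
  a (suc n)                                             ∎

∂-leibniz : ∀ (a b : Seq) → ∂ (a ⊛ b) ≗ λ n → (∂ a ⊛ b) n + (a ⊛ ∂ b) n
∂-leibniz a b n = begin
  ι n * Σ≤ n (λ j → a (n ℕ.∸ j) * b j)                                            ≡⟨ *-distribˡ-Σ≤ n (ι n) _ ⟩
  Σ≤ n (λ j → ι n * (a (n ℕ.∸ j) * b j))                                          ≡⟨ Σ≤-cong n split ⟩
  Σ≤ n (λ j → ι (n ℕ.∸ j) * a (n ℕ.∸ j) * b j + a (n ℕ.∸ j) * (ι j * b j))        ≡⟨ Σ≤-distrib-+ n _ _ ⟩
  (∂ a ⊛ b) n + (a ⊛ ∂ b) n                                                       ∎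
  where
  distrib : ∀ p q x y → (p + q) * (x * y) ≡ p * x * y + x * (q * y)
  distrib = solve-∀ ℚ-ring
  split : ∀ j → j ≤ n → ι n * (a (n ℕ.∸ j) * b j) ≡ ι (n ℕ.∸ j) * a (n ℕ.∸ j) * b j + a (n ℕ.∸ j) * (ι j * b j)
  split j j≤n = begin
    ι n * (a (n ℕ.∸ j) * b j)                  ≡⟨ cong (λ m → ι m * (a (n ℕ.∸ j) * b j)) (ℕP.m∸n+n≡m j≤n) ⟨
    ι (n ℕ.∸ j ℕ.+ j) * (a (n ℕ.∸ j) * b j)    ≡⟨ cong (_* (a (n ℕ.∸ j) * b j)) (ι-+ (n ℕ.∸ j) j) ⟩
    (ι (n ℕ.∸ j) + ι j) * (a (n ℕ.∸ j) * b j)  ≡⟨ distrib (ι (n ℕ.∸ j)) (ι j) (a (n ℕ.∸ j)) (b j) ⟩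
    ι (n ℕ.∸ j) * a (n ℕ.∸ j) * b j + a (n ℕ.∸ j) * (ι j * b j) ∎

⊛-inverse-unique : ∀ (a b c : Seq) → a ⊛ b ≗ δ → a ⊛ c ≗ δ → b ≗ c
⊛-inverse-unique a b c ab≗δ ac≗δ n = begin
  b n               ≡⟨ ⊛-identityʳ b n ⟨
  (b ⊛ δ) n         ≡⟨ ⊛-congʳ b ac≗δ n ⟨
  (b ⊛ (a ⊛ c)) n   ≡⟨ ⊛-assoc b a c n ⟨
  ((b ⊛ a) ⊛ c) n   ≡⟨ ⊛-congˡ c ba≗δ n ⟩
  (δ ⊛ c) n         ≡⟨ ⊛-comm δ c n ⟩
  (c ⊛ δ) n         ≡⟨ ⊛-identityʳ c n ⟩
  c n               ∎
  where
  ba≗δ : b ⊛ a ≗ δ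
  ba≗δ m = trans (⊛-comm b a m) (ab≗δ m)

affine-fixpoint-unique : ∀ (τ g X Z : Seq) → τ 0 ≡ 0ℚ →
  (∀ n → X n ≡ (X ⊛ τ) n + g n) → (∀ n → Z n ≡ (Z ⊛ τ) n + g n) → X ≗ Z
affine-fixpoint-unique τ g X Z τ₀ X-fix Z-fix = <-rec (λ n → X n ≡ Z n) step
  where
  step : ∀ n → (∀ {m} → m < n → X m ≡ Z m) → X n ≡ Z n
  step n X≡Z-below = begin
    X n              ≡⟨ X-fix n ⟩
    (X ⊛ τ) n + g n  ≡⟨ cong (_+ g n) (Σ≤-cong n term) ⟩
    (Z ⊛ τ) n + g n  ≡⟨ Z-fix n ⟨
    Z n              ∎
    where
    term : ∀ j → j ≤ n → X (n ℕ.∸ j) * τ j ≡ Z (n ℕ.∸ j) * τ j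
    term zero    _   rewrite τ₀ = trans (ℚP.*-zeroʳ (X n)) (sym (ℚP.*-zeroʳ (Z n)))
    term (suc j) j<n = cong (_* τ (suc j)) (X≡Z-below (ℕP.∸-monoʳ-< (s≤s z≤n) j<n))

module Recurrence (F τ : Seq) (τ₀ : τ 0 ≡ 0ℚ) (F₀ : F 0 ≡ 1ℚ)
                  (F-rec : ∀ n → F (suc n) ≡ (F ⊛ τ) (suc n)) where

  F≗δ+F⊛τ : F ≗ λ n → δ n + (F ⊛ τ) n
  F≗δ+F⊛τ zero    = begin
    F 0            ≡⟨ F₀ ⟩
    1ℚ             ≡⟨ ℚP.+-identityʳ 1ℚ ⟨
    1ℚ + 0ℚ        ≡⟨ cong (λ x → 1ℚ + x) (ℚP.*-zeroʳ (F 0)) ⟨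
    1ℚ + F 0 * 0ℚ  ≡⟨ cong (λ x → 1ℚ + F 0 * x) τ₀ ⟨
    1ℚ + F 0 * τ 0 ∎
  F≗δ+F⊛τ (suc n) = trans (F-rec n) (sym (ℚP.+-identityˡ _))

  F⊛[δ-τ]≗δ : F ⊛ (λ n → δ n - τ n) ≗ δ
  F⊛[δ-τ]≗δ n = begin
    (F ⊛ (λ m → δ m - τ m)) n         ≡⟨ ⊛-distribˡ-+ F δ (λ m → - τ m) n ⟩
    (F ⊛ δ) n + (F ⊛ (λ m → - τ m)) n  ≡⟨ cong₂ _+_ (trans (⊛-identityʳ F n) (F≗δ+F⊛τ n)) (⊛-negʳ F τ n) ⟩
    δ n + (F ⊛ τ) n - (F ⊛ τ) n       ≡⟨ cancel (δ n) ((F ⊛ τ) n) ⟩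
    δ n                               ∎
    where
    cancel : ∀ x y → x + y - y ≡ x
    cancel = solve-∀ ℚ-ring

  ∂F≗F⊛[F⊛∂τ] : ∂ F ≗ F ⊛ (F ⊛ ∂ τ)
  ∂F≗F⊛[F⊛∂τ] = affine-fixpoint-unique τ g (∂ F) (F ⊛ g) τ₀ ∂F-fix F⊛g-fix
    where
    g : Seq
    g = F ⊛ ∂ τ
    ∂F≗∂[F⊛τ] : ∂ F ≗ ∂ (F ⊛ τ)
    ∂F≗∂[F⊛τ] zero    = trans (ℚP.*-zeroˡ (F 0)) (sym (ℚP.*-zeroˡ ((F ⊛ τ) 0)))
    ∂F≗∂[F⊛τ] (suc n) = cong (ι (suc n) *_) (F-rec n)
    ∂F-fix : ∀ n → ∂ F n ≡ (∂ F ⊛ τ) n + g n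
    ∂F-fix n = trans (∂F≗∂[F⊛τ] n) (∂-leibniz F τ n)
    F⊛g-fix : ∀ n → (F ⊛ g) n ≡ ((F ⊛ g) ⊛ τ) n + g n
    F⊛g-fix n = begin
      (F ⊛ g) n                            ≡⟨ ⊛-comm F g n ⟩
      (g ⊛ F) n                            ≡⟨ ⊛-congʳ g F≗δ+F⊛τ n ⟩
      (g ⊛ (λ m → δ m + (F ⊛ τ) m)) n      ≡⟨ ⊛-distribˡ-+ g δ (F ⊛ τ) n ⟩
      (g ⊛ δ) n + (g ⊛ (F ⊛ τ)) n          ≡⟨ cong₂ _+_ (⊛-identityʳ g n) (sym (⊛-assoc g F τ n)) ⟩
      g n + ((g ⊛ F) ⊛ τ) n                ≡⟨ cong (λ x → g n + x) (⊛-congˡ τ (⊛-comm g F) n) ⟩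
      g n + ((F ⊛ g) ⊛ τ) n                ≡⟨ ℚP.+-comm (g n) _ ⟩
      ((F ⊛ g) ⊛ τ) n + g n                ∎

-- The Fibonacci recurrence

nth-Fhist-≤ : ∀ {k} (t : Vec ℚ k) n c → c ≤ n → nth (Fhist t n) c ≡ F t (n ℕ.∸ c)
nth-Fhist-≤ t zero    zero    _         = refl
nth-Fhist-≤ t (suc n) zero    _         = refl
nth-Fhist-≤ t (suc n) (suc c) (s≤s c≤n) = nth-Fhist-≤ t n c c≤n

nth-Fhist-> : ∀ {k} (t : Vec ℚ k) n c → n < c → nth (Fhist t n) c ≡ 0ℚ
nth-Fhist-> t zero    (suc zero)    _         = refl
nth-Fhist-> t zero    (suc (suc c)) _         = refl
nth-Fhist-> t (suc n) (suc c)       (s≤s n<c) = nth-Fhist-> t n c n<c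

Σ≤-Fhist≡⊛ : ∀ {k} (t : Vec ℚ k) n (w : Seq) → Σ≤ n (λ j → nth (Fhist t n) j * w j) ≡ (F t ⊛ w) n
Σ≤-Fhist≡⊛ t n w = Σ≤-cong n (λ j j≤n → cong (_* w j) (nth-Fhist-≤ t n j j≤n))

tc-beyond : ∀ {k} (t : Vec ℚ k) j → k < j → tc t j ≡ 0ℚ
tc-beyond []      zero          _         = refl
tc-beyond []      (suc j)       _         = refl
tc-beyond (x ∷ t) (suc zero)    (s≤s ())
tc-beyond (x ∷ t) (suc (suc j)) (s≤s k<j) = tc-beyond t (suc j) k<j

Σ1≤-cong : ∀ n {f g : ℕ → ℚ} → (∀ j → f (suc j) ≡ g (suc j)) → Σ1≤ n f ≡ Σ1≤ n g
Σ1≤-cong zero    f≡g = refl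
Σ1≤-cong (suc n) f≡g = cong₂ _+_ (Σ1≤-cong n f≡g) (f≡g n)

Σ1≤[tc*y]≡Σ≤[y*tc] : ∀ {k} (t : Vec ℚ k) m (y : ℕ → ℚ) → (∀ j → m < j → y j ≡ 0ℚ) →
  Σ1≤ k (λ j → tc t j * y j) ≡ Σ≤ m (λ j → y j * tc t j)
Σ1≤[tc*y]≡Σ≤[y*tc] {k} t m y y≡0 = begin
  Σ1≤ k (λ j → tc t j * y j)  ≡⟨ Σ1≤-cong k (λ j → ℚP.*-comm (tc t (suc j)) (y (suc j))) ⟩
  Σ1≤ k f                     ≡⟨ ℚP.+-identityˡ _ ⟨
  0ℚ + Σ1≤ k f                ≡⟨ cong (_+ Σ1≤ k f) (ℚP.*-zeroʳ (y 0)) ⟨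
  f 0 + Σ1≤ k f               ≡⟨ Σ≤≡head+Σ1≤ k f ⟨
  Σ≤ k f                      ≡⟨ Σ≤-extend k m (λ j k<j → trans (cong (y j *_) (tc-beyond t j k<j)) (ℚP.*-zeroʳ (y j))) ⟨
  Σ≤ (k ℕ.+ m) f              ≡⟨ cong (λ n → Σ≤ n f) (ℕP.+-comm k m) ⟩
  Σ≤ (m ℕ.+ k) f              ≡⟨ Σ≤-extend m k (λ j m<j → trans (cong (_* tc t j) (y≡0 j m<j)) (ℚP.*-zeroˡ (tc t j))) ⟩
  Σ≤ m f                      ∎
  where
  f : ℕ → ℚ
  f j = y j * tc t j

F-recurrence : ∀ {k} (t : Vec ℚ k) n → F t (suc n) ≡ (F t ⊛ tc t) (suc n)
F-recurrence {k} t n = begin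
  Σ1≤ k (λ j → tc t j * nth (Fhist t n) (j ℕ.∸ 1))        ≡⟨ Σ1≤-cong k (λ _ → refl) ⟩
  Σ1≤ k (λ j → tc t j * nth (Fhist t (suc n)) j)         ≡⟨ Σ1≤[tc*y]≡Σ≤[y*tc] t (suc n) _ (nth-Fhist-> t (suc n)) ⟩
  Σ≤ (suc n) (λ j → nth (Fhist t (suc n)) j * tc t j)    ≡⟨ Σ≤-Fhist≡⊛ t (suc n) (tc t) ⟩
  (F t ⊛ tc t) (suc n)                                    ∎

-- Multinomial expansions of F and G

𝟙 : {P : Set} → Dec P → ℚ
𝟙 (yes _) = 1ℚ
𝟙 (no _)  = 0ℚ

𝟙[_≡_] : ℕ → ℕ → ℚ
𝟙[ m ≡ n ] = 𝟙 (m ℕ.≟ n)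

𝟙[≡]-no : ∀ {m n} → m ≢ n → 𝟙[ m ≡ n ] ≡ 0ℚ
𝟙[≡]-no {m} {n} m≢n with m ℕ.≟ n
... | yes m≡n = contradiction m≡n m≢n
... | no _    = refl

𝟙[≡]-cong : ∀ {m n m′ n′} → (m ≡ n → m′ ≡ n′) → (m′ ≡ n′ → m ≡ n) → 𝟙[ m ≡ n ] ≡ 𝟙[ m′ ≡ n′ ]
𝟙[≡]-cong {m} {n} {m′} {n′} to from with m ℕ.≟ n | m′ ℕ.≟ n′
... | yes _   | yes _    = refl
... | no _    | no _     = refl
... | yes m≡n | no m′≢n′ = contradiction (to m≡n) m′≢n′
... | no m≢n  | yes m′≡n′ = contradiction (from m′≡n′) m≢n

𝟙[≡]*-cong : ∀ m n {x y} → (m ≡ n → x ≡ y) → 𝟙[ m ≡ n ] * x ≡ 𝟙[ m ≡ n ] * y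
𝟙[≡]*-cong m n {x} {y} x≡y with m ℕ.≟ n
... | yes m≡n = cong (1ℚ *_) (x≡y m≡n)
... | no _    = trans (ℚP.*-zeroˡ x) (sym (ℚP.*-zeroˡ y))

ΣL : {A : Set} → List A → (A → ℚ) → ℚ
ΣL xs h = sumℚ (L.map h xs)

ΣL-cong : ∀ {A : Set} (xs : List A) {h h′ : A → ℚ} → h ≗ h′ → ΣL xs h ≡ ΣL xs h′
ΣL-cong L.[]       h≗h′ = refl
ΣL-cong (x L.∷ xs) h≗h′ = cong₂ _+_ (h≗h′ x) (ΣL-cong xs h≗h′)

ΣL-zero : ∀ {A : Set} (xs : List A) {h : A → ℚ} → (∀ a → h a ≡ 0ℚ) → ΣL xs h ≡ 0ℚ
ΣL-zero L.[]       h≡0 = refl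
ΣL-zero (x L.∷ xs) h≡0 = trans (cong₂ _+_ (h≡0 x) (ΣL-zero xs h≡0)) (ℚP.+-identityˡ 0ℚ)

ΣL-distrib-+ : ∀ {A : Set} (xs : List A) (h h′ : A → ℚ) → ΣL xs (λ a → h a + h′ a) ≡ ΣL xs h + ΣL xs h′
ΣL-distrib-+ L.[]       h h′ = sym (ℚP.+-identityˡ 0ℚ)
ΣL-distrib-+ (x L.∷ xs) h h′ = trans (cong (λ s → (h x + h′ x) + s) (ΣL-distrib-+ xs h h′))
                                     (interchange (h x) (h′ x) (ΣL xs h) (ΣL xs h′))
  where
  interchange : ∀ a b c d → (a + b) + (c + d) ≡ (a + c) + (b + d)
  interchange = solve-∀ ℚ-ring

*-distribˡ-ΣL : ∀ {A : Set} (xs : List A) c (h : A → ℚ) → c * ΣL xs h ≡ ΣL xs (λ a → c * h a)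
*-distribˡ-ΣL L.[]       c h = ℚP.*-zeroʳ c
*-distribˡ-ΣL (x L.∷ xs) c h = trans (ℚP.*-distribˡ-+ c (h x) (ΣL xs h)) (cong (λ s → c * h x + s) (*-distribˡ-ΣL xs c h))

ΣL-++ : ∀ {A : Set} (xs ys : List A) (h : A → ℚ) → ΣL (xs L.++ ys) h ≡ ΣL xs h + ΣL ys h
ΣL-++ L.[]       ys h = sym (ℚP.+-identityˡ _)
ΣL-++ (x L.∷ xs) ys h = trans (cong (λ s → h x + s) (ΣL-++ xs ys h)) (sym (ℚP.+-assoc (h x) (ΣL xs h) (ΣL ys h)))

ΣL-concatMap : ∀ {A B : Set} (f : A → List B) (xs : List A) (h : B → ℚ) →
  ΣL (L.concatMap f xs) h ≡ ΣL xs (λ a → ΣL (f a) h)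
ΣL-concatMap f L.[]       h = refl
ΣL-concatMap f (x L.∷ xs) h = trans (ΣL-++ (f x) (L.concatMap f xs) h) (cong (λ s → ΣL (f x) h + s) (ΣL-concatMap f xs h))

ΣL-map : ∀ {A B : Set} (f : A → B) (xs : List A) (h : B → ℚ) → ΣL (L.map f xs) h ≡ ΣL xs (λ a → h (f a))
ΣL-map f L.[]       h = refl
ΣL-map f (x L.∷ xs) h = cong (λ s → h (f x) + s) (ΣL-map f xs h)

ΣL-applyUpTo : ∀ n (f : ℕ → ℕ) (h : ℕ → ℚ) → ΣL (L.applyUpTo f (suc n)) h ≡ Σ≤ n (λ a → h (f a))
ΣL-applyUpTo zero    f h = ℚP.+-identityʳ (h (f 0))
ΣL-applyUpTo (suc n) f h = trans (cong (λ s → h (f 0) + s) (ΣL-applyUpTo n (λ a → f (suc a)) h))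
                                 (sym (Σ≤-head n (λ a → h (f a))))

ΣL-filter : ∀ {A : Set} {P : A → Set} (P? : ∀ a → Dec (P a)) (xs : List A) (h : A → ℚ) →
  ΣL (L.filter P? xs) h ≡ ΣL xs (λ a → 𝟙 (P? a) * h a)
ΣL-filter P? L.[]       h = refl
ΣL-filter P? (x L.∷ xs) h with P? x
... | yes _ = cong₂ _+_ (sym (ℚP.*-identityˡ (h x))) (ΣL-filter P? xs h)
... | no _  = begin
  ΣL (L.filter P? xs) h                         ≡⟨ ΣL-filter P? xs h ⟩
  ΣL xs (λ a → 𝟙 (P? a) * h a)                  ≡⟨ ℚP.+-identityˡ _ ⟨
  0ℚ + ΣL xs (λ a → 𝟙 (P? a) * h a)             ≡⟨ cong (_+ ΣL xs (λ a → 𝟙 (P? a) * h a)) (ℚP.*-zeroˡ (h x)) ⟨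
  0ℚ * h x + ΣL xs (λ a → 𝟙 (P? a) * h a)       ∎

ΣL-sum : ∀ {A : Set} (xs : List A) {k} (h : Fin k → A → ℚ) →
  ΣL xs (λ a → ∑[ j < k ] h j a) ≡ ∑[ j < k ] ΣL xs (h j)
ΣL-sum xs {zero}  h = ΣL-zero xs (λ _ → refl)
ΣL-sum xs {suc k} h = trans (ΣL-distrib-+ xs _ _) (cong (λ s → ΣL xs (h zero) + s) (ΣL-sum xs (λ j → h (suc j))))

Σbox : (k M : ℕ) → (Vec ℕ k → ℚ) → ℚ
Σbox k M = ΣL (boxes k M)

Σbox-suc : ∀ k M (h : Vec ℕ (suc k) → ℚ) → Σbox (suc k) M h ≡ Σ≤ M (λ a → Σbox k M (λ β → h (a ∷ β)))
Σbox-suc k M h = begin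
  ΣL (L.concatMap (λ a → L.map (a ∷_) (boxes k M)) (L.upTo (suc M))) h
    ≡⟨ ΣL-concatMap (λ a → L.map (a ∷_) (boxes k M)) (L.upTo (suc M)) h ⟩
  ΣL (L.upTo (suc M)) (λ a → ΣL (L.map (a ∷_) (boxes k M)) h)
    ≡⟨ ΣL-cong (L.upTo (suc M)) (λ a → ΣL-map (a ∷_) (boxes k M) h) ⟩
  ΣL (L.upTo (suc M)) (λ a → Σbox k M (λ β → h (a ∷ β)))
    ≡⟨ ΣL-applyUpTo M (λ a → a) _ ⟩
  Σ≤ M (λ a → Σbox k M (λ β → h (a ∷ β))) ∎

-- weight = weightBy toℕ; the offsets g let the recursion pass to the tail of a vector.
weightBy : ∀ {k} → (Fin k → ℕ) → Vec ℕ k → ℕ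
weightBy g α = V.sum (V.zipWith ℕ._*_ (V.tabulate (λ i → suc (g i))) α)

≤-weightBy : ∀ {k} (g : Fin k → ℕ) (α : Vec ℕ k) → All (_≤ weightBy g α) α
≤-weightBy g []      = []
≤-weightBy g (a ∷ α) = ℕP.≤-trans (ℕP.m≤m+n a (g zero ℕ.* a)) (ℕP.m≤m+n _ _)
                     ∷ All.map (λ b≤ → ℕP.≤-trans b≤ (ℕP.m≤n+m _ _)) (≤-weightBy (λ i → g (suc i)) α)

Σbox-weight≡0 : ∀ k M (g : Fin k → ℕ) (h : Vec ℕ k → ℚ) →
  Σbox k M (λ α → 𝟙[ weightBy g α ≡ 0 ] * h α) ≡ h (V.replicate k 0)
Σbox-weight≡0 zero    M g h = trans (ℚP.+-identityʳ (1ℚ * h [])) (ℚP.*-identityˡ (h []))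
Σbox-weight≡0 (suc k) M g h = begin
  Σbox (suc k) M (λ α → 𝟙[ weightBy g α ≡ 0 ] * h α)
    ≡⟨ Σbox-suc k M _ ⟩
  Σ≤ M (λ a → Σbox k M (λ β → 𝟙[ weightBy g (a ∷ β) ≡ 0 ] * h (a ∷ β)))
    ≡⟨ Σ≤≡head+Σ1≤ M _ ⟩
  Σbox k M (λ β → 𝟙[ weightBy g (0 ∷ β) ≡ 0 ] * h (0 ∷ β)) + Σ1≤ M (λ a → Σbox k M (λ β → 𝟙[ weightBy g (a ∷ β) ≡ 0 ] * h (a ∷ β)))
    ≡⟨ cong₂ _+_ (ΣL-cong (boxes k M) (λ β → cong (λ w → 𝟙[ w ℕ.+ weightBy g′ β ≡ 0 ] * h (0 ∷ β)) (ℕP.*-zeroʳ (suc (g zero)))))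
                 (Σ1≤-zero M (λ a → ΣL-zero (boxes k M) (λ β → trans (cong (_* h (suc a ∷ β)) (𝟙[≡]-no {weightBy g (suc a ∷ β)} {0} (λ ()))) (ℚP.*-zeroˡ (h (suc a ∷ β)))))) ⟩
  Σbox k M (λ β → 𝟙[ weightBy g′ β ≡ 0 ] * h (0 ∷ β)) + 0ℚ
    ≡⟨ ℚP.+-identityʳ _ ⟩
  Σbox k M (λ β → 𝟙[ weightBy g′ β ≡ 0 ] * h (0 ∷ β))
    ≡⟨ Σbox-weight≡0 k M g′ (λ β → h (0 ∷ β)) ⟩
  h (V.replicate (suc k) 0) ∎
  where
  g′ : Fin k → ℕ
  g′ i = g (suc i)

shiftDown : ∀ {k} → Fin k → (Vec ℕ k → ℚ) → Vec ℕ k → ℚ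
shiftDown zero    h (zero  ∷ β) = 0ℚ
shiftDown zero    h (suc a ∷ β) = h (a ∷ β)
shiftDown (suc j) h (a ∷ β)     = shiftDown j (λ γ → h (a ∷ γ)) β

shiftDown-cong : ∀ {k} (j : Fin k) {h h′ : Vec ℕ k → ℚ} → h ≗ h′ → shiftDown j h ≗ shiftDown j h′
shiftDown-cong zero    h≗h′ (zero  ∷ β) = refl
shiftDown-cong zero    h≗h′ (suc a ∷ β) = h≗h′ (a ∷ β)
shiftDown-cong (suc j) h≗h′ (a ∷ β)     = shiftDown-cong j (λ γ → h≗h′ (a ∷ γ)) β

shiftDown-*ˡ : ∀ {k} (j : Fin k) c (h : Vec ℕ k → ℚ) α → shiftDown j (λ β → c * h β) α ≡ c * shiftDown j h α
shiftDown-*ˡ zero    c h (zero  ∷ β) = sym (ℚP.*-zeroʳ c)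
shiftDown-*ˡ zero    c h (suc a ∷ β) = refl
shiftDown-*ˡ (suc j) c h (a ∷ β)     = shiftDown-*ˡ j c (λ γ → h (a ∷ γ)) β

shiftDown-*ʳ : ∀ {k} (j : Fin k) c (h : Vec ℕ k → ℚ) α → shiftDown j (λ β → h β * c) α ≡ shiftDown j h α * c
shiftDown-*ʳ j c h α = trans (shiftDown-cong j (λ β → ℚP.*-comm (h β) c) α) (trans (shiftDown-*ˡ j c h α) (ℚP.*-comm c _))

shiftDown-weightBy : ∀ {k} (g : Fin k → ℕ) (j : Fin k) (φ : ℕ → Vec ℕ k → ℚ) α →
  shiftDown j (λ β → φ (weightBy g β ℕ.+ suc (g j)) β) α ≡ shiftDown j (φ (weightBy g α)) α
shiftDown-weightBy g zero    φ (zero  ∷ β) = refl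
shiftDown-weightBy g zero    φ (suc a ∷ β) = cong (λ w → φ w (a ∷ β)) (cross-multiply (g zero) a (weightBy (λ i → g (suc i)) β))
  where
  cross-multiply : ∀ x a w → (suc x ℕ.* a ℕ.+ w) ℕ.+ suc x ≡ suc x ℕ.* suc a ℕ.+ w
  cross-multiply = ℕSolver.solve-∀
shiftDown-weightBy g (suc j) φ (a ∷ β) = trans
  (shiftDown-cong j (λ γ → cong (λ w → φ w (a ∷ γ)) (ℕP.+-assoc (suc (g zero) ℕ.* a) (weightBy (λ i → g (suc i)) γ) (suc (g (suc j))))) β)
  (shiftDown-weightBy (λ i → g (suc i)) j (λ w γ → φ (suc (g zero) ℕ.* a ℕ.+ w) (a ∷ γ)) β)

shiftDown-size : ∀ {k} (j : Fin k) (φ : ℕ → Vec ℕ k → ℚ) α →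
  shiftDown j (λ β → φ (V.sum β ℕ.+ 1) β) α ≡ shiftDown j (φ (V.sum α)) α
shiftDown-size zero    φ (zero  ∷ β) = refl
shiftDown-size zero    φ (suc a ∷ β) = cong (λ w → φ w (a ∷ β)) (ℕP.+-comm (a ℕ.+ V.sum β) 1)
shiftDown-size (suc j) φ (a ∷ β)     = trans
  (shiftDown-cong j (λ γ → cong (λ w → φ w (a ∷ γ)) (ℕP.+-assoc a (V.sum γ) 1)) β)
  (shiftDown-size j (λ w γ → φ (a ℕ.+ w) (a ∷ γ)) β)

Σbox-shiftDown : ∀ {k} (j : Fin k) M N (h : Vec ℕ k → ℚ) → N < M → (∀ α → ¬ All (_≤ N) α → h α ≡ 0ℚ) →
  Σbox k M (shiftDown j h) ≡ Σbox k M h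
Σbox-shiftDown {suc k} zero (suc M) N h N<M h≡0 = begin
  Σbox (suc k) (suc M) (shiftDown zero h)                   ≡⟨ Σbox-suc k (suc M) _ ⟩
  Σ≤ (suc M) (λ a → Σbox k (suc M) (shiftDown zero h ∘ (a ∷_))) ≡⟨ Σ≤-head M _ ⟩
  Σbox k (suc M) (λ _ → 0ℚ) + Σ≤ M slice                    ≡⟨ cong (_+ Σ≤ M slice) (ΣL-zero (boxes k (suc M)) (λ _ → refl)) ⟩
  0ℚ + Σ≤ M slice                                           ≡⟨ ℚP.+-comm 0ℚ (Σ≤ M slice) ⟩
  Σ≤ M slice + 0ℚ                                           ≡⟨ cong (λ x → Σ≤ M slice + x) top-slice≡0 ⟨
  Σ≤ (suc M) slice                                          ≡⟨ Σbox-suc k (suc M) h ⟨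
  Σbox (suc k) (suc M) h                                    ∎
  where
  slice : ℕ → ℚ
  slice a = Σbox k (suc M) (λ β → h (a ∷ β))
  top-slice≡0 : slice (suc M) ≡ 0ℚ
  top-slice≡0 = ΣL-zero (boxes k (suc M)) (λ β → h≡0 (suc M ∷ β) (λ { (M≤N ∷ _) → ℕP.<⇒≱ N<M M≤N }))
Σbox-shiftDown {suc k} (suc j) M N h N<M h≡0 = begin
  Σbox (suc k) M (shiftDown (suc j) h)                          ≡⟨ Σbox-suc k M _ ⟩
  Σ≤ M (λ a → Σbox k M (shiftDown j (λ β → h (a ∷ β))))         ≡⟨ Σ≤-cong M (λ a _ → Σbox-shiftDown j M N (λ β → h (a ∷ β)) N<M (tail≡0 a)) ⟩
  Σ≤ M (λ a → Σbox k M (λ β → h (a ∷ β)))                       ≡⟨ Σbox-suc k M h ⟨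
  Σbox (suc k) M h                                              ∎
  where
  tail≡0 : ∀ a β → ¬ All (_≤ N) β → h (a ∷ β) ≡ 0ℚ
  tail≡0 a β β≰N = h≡0 (a ∷ β) (λ { (_ ∷ β≤N) → β≰N β≤N })

invFactorials : ∀ {k} → Vec ℕ k → ℚ
invFactorials = V.foldr _ (λ a r → (+ 1 / (a !)) {{a !≢0}} * r) 1ℚ

multiTerm : ∀ {k} → Vec ℚ k → Vec ℕ k → ℚ
multiTerm t α = multinomial α * tpow t α

-- multiTerm = multiTermFrom 0; the offset c is the size of the prefix already consumed.
multiTermFrom : ∀ {k} → ℕ → Vec ℚ k → Vec ℕ k → ℚ
multiTermFrom c t α = ι ((c ℕ.+ V.sum α) !) * invFactorials α * tpow t α

multiTermFrom-∷ : ∀ {k} c x (t : Vec ℚ k) a (γ : Vec ℕ k) →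
  multiTermFrom c (x ∷ t) (a ∷ γ) ≡ ((+ 1 / (a !)) {{a !≢0}} * x ^ℚ a) * multiTermFrom (c ℕ.+ a) t γ
multiTermFrom-∷ c x t a γ = begin
  ι ((c ℕ.+ (a ℕ.+ V.sum γ)) !) * (r * invFactorials γ) * (x ^ℚ a * tpow t γ)
    ≡⟨ cong (λ n → ι (n !) * (r * invFactorials γ) * (x ^ℚ a * tpow t γ)) (ℕP.+-assoc c a (V.sum γ)) ⟨
  ι ((c ℕ.+ a ℕ.+ V.sum γ) !) * (r * invFactorials γ) * (x ^ℚ a * tpow t γ)
    ≡⟨ regroup (ι ((c ℕ.+ a ℕ.+ V.sum γ) !)) r (invFactorials γ) (x ^ℚ a) (tpow t γ) ⟩
  (r * x ^ℚ a) * multiTermFrom (c ℕ.+ a) t γ ∎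
  where
  r : ℚ
  r = (+ 1 / (a !)) {{a !≢0}}
  regroup : ∀ f r q y z → f * (r * q) * (y * z) ≡ (r * y) * (f * q * z)
  regroup = solve-∀ ℚ-ring

shiftDown-multiTermFrom : ∀ {k} (t : Vec ℚ k) c (j : Fin k) α →
  shiftDown j (λ β → lookup t j * multiTermFrom c t β * ι (c ℕ.+ (V.sum β ℕ.+ 1))) α ≡ ι (lookup α j) * multiTermFrom c t α
shiftDown-multiTermFrom (x ∷ t) c zero (zero ∷ β) = sym (ℚP.*-zeroˡ (multiTermFrom c (x ∷ t) (zero ∷ β)))
shiftDown-multiTermFrom (x ∷ t) c zero (suc a ∷ β) = begin
  x * (ι (N !) * (A * Q) * (x ^ℚ a * T)) * ι (c ℕ.+ ((a ℕ.+ s) ℕ.+ 1))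
    ≡⟨ cong₂ (λ A′ m → x * (ι (N !) * (A′ * Q) * (x ^ℚ a * T)) * ι m) (sym (ι[1+n]*1/[1+n]!≡1/n! a)) c+[s+1]≡1+N ⟩
  x * (ι (N !) * ((ι (suc a) * B) * Q) * (x ^ℚ a * T)) * ι (suc N)
    ≡⟨ regroup x (ι (N !)) (ι (suc a)) B Q (x ^ℚ a) T (ι (suc N)) ⟩
  ι (suc a) * ((ι (suc N) * ι (N !)) * (B * Q) * (x * x ^ℚ a * T))
    ≡⟨ cong (λ f → ι (suc a) * (f * (B * Q) * (x * x ^ℚ a * T))) (ι-* (suc N) (N !)) ⟨
  ι (suc a) * (ι (suc N !) * (B * Q) * (x * x ^ℚ a * T))
    ≡⟨ cong (λ n → ι (suc a) * (ι (n !) * (B * Q) * (x * x ^ℚ a * T))) (ℕP.+-suc c (a ℕ.+ s)) ⟨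
  ι (suc a) * multiTermFrom c (x ∷ t) (suc a ∷ β) ∎
  where
  s N : ℕ
  s = V.sum β
  N = c ℕ.+ (a ℕ.+ s)
  A B Q T : ℚ
  A = (+ 1 / (a !)) {{a !≢0}}
  B = (+ 1 / (suc a !)) {{suc a !≢0}}
  Q = invFactorials β
  T = tpow t β
  c+[s+1]≡1+N : c ℕ.+ ((a ℕ.+ s) ℕ.+ 1) ≡ suc N
  c+[s+1]≡1+N = trans (cong (c ℕ.+_) (ℕP.+-comm (a ℕ.+ s) 1)) (ℕP.+-suc c (a ℕ.+ s))
  regroup : ∀ x f a b q y z n → x * (f * ((a * b) * q) * (y * z)) * n ≡ a * ((n * f) * (b * q) * (x * y * z))
  regroup = solve-∀ ℚ-ring
shiftDown-multiTermFrom (x ∷ t) c (suc j) (a ∷ β) = begin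
  shiftDown j (λ γ → lookup t j * multiTermFrom c (x ∷ t) (a ∷ γ) * ι (c ℕ.+ ((a ℕ.+ V.sum γ) ℕ.+ 1))) β
    ≡⟨ shiftDown-cong j pull-out β ⟩
  shiftDown j (λ γ → K * (lookup t j * multiTermFrom (c ℕ.+ a) t γ * ι ((c ℕ.+ a) ℕ.+ (V.sum γ ℕ.+ 1)))) β
    ≡⟨ shiftDown-*ˡ j K _ β ⟩
  K * shiftDown j (λ γ → lookup t j * multiTermFrom (c ℕ.+ a) t γ * ι ((c ℕ.+ a) ℕ.+ (V.sum γ ℕ.+ 1))) β
    ≡⟨ cong (K *_) (shiftDown-multiTermFrom t (c ℕ.+ a) j β) ⟩
  K * (ι (lookup β j) * multiTermFrom (c ℕ.+ a) t β)
    ≡⟨ swap K (ι (lookup β j)) _ ⟩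
  ι (lookup β j) * (K * multiTermFrom (c ℕ.+ a) t β)
    ≡⟨ cong (ι (lookup β j) *_) (multiTermFrom-∷ c x t a β) ⟨
  ι (lookup β j) * multiTermFrom c (x ∷ t) (a ∷ β) ∎
  where
  K : ℚ
  K = (+ 1 / (a !)) {{a !≢0}} * x ^ℚ a
  regroup : ∀ l K p i → l * (K * p) * i ≡ K * (l * p * i)
  regroup = solve-∀ ℚ-ring
  swap : ∀ K l p → K * (l * p) ≡ l * (K * p)
  swap = solve-∀ ℚ-ring
  reassoc : ∀ c a s → c ℕ.+ ((a ℕ.+ s) ℕ.+ 1) ≡ (c ℕ.+ a) ℕ.+ (s ℕ.+ 1)
  reassoc = ℕSolver.solve-∀
  pull-out : ∀ γ → lookup t j * multiTermFrom c (x ∷ t) (a ∷ γ) * ι (c ℕ.+ ((a ℕ.+ V.sum γ) ℕ.+ 1))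
                 ≡ K * (lookup t j * multiTermFrom (c ℕ.+ a) t γ * ι ((c ℕ.+ a) ℕ.+ (V.sum γ ℕ.+ 1)))
  pull-out γ = trans
    (cong₂ (λ p m → lookup t j * p * ι m) (multiTermFrom-∷ c x t a γ) (reassoc c a (V.sum γ)))
    (regroup (lookup t j) K (multiTermFrom (c ℕ.+ a) t γ) _)

stepTerm : ∀ {k} → Vec ℚ k → Fin k → Vec ℕ k → ℚ
stepTerm t j = shiftDown j (λ β → lookup t j * multiTerm t β)

stepTerm*size : ∀ {k} (t : Vec ℚ k) (j : Fin k) α →
  stepTerm t j α * ι (V.sum α) ≡ ι (lookup α j) * multiTerm t α
stepTerm*size t j α = begin
  shiftDown j (λ β → lookup t j * multiTerm t β) α * ι (V.sum α)     ≡⟨ shiftDown-*ʳ j (ι (V.sum α)) _ α ⟨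
  shiftDown j (λ β → lookup t j * multiTerm t β * ι (V.sum α)) α     ≡⟨ shiftDown-size j (λ s β → lookup t j * multiTerm t β * ι s) α ⟨
  shiftDown j (λ β → lookup t j * multiTerm t β * ι (V.sum β ℕ.+ 1)) α ≡⟨ shiftDown-multiTermFrom t 0 j α ⟩
  ι (lookup α j) * multiTerm t α                                     ∎

∑-ι-lookup : ∀ {k} (α : Vec ℕ k) → ∑[ j < k ] ι (lookup α j) ≡ ι (V.sum α)
∑-ι-lookup []      = refl
∑-ι-lookup (a ∷ α) = trans (cong (λ x → ι a + x) (∑-ι-lookup α)) (sym (ι-+ a (V.sum α)))

∑-ι-weightBy : ∀ {k} (g : Fin k → ℕ) (α : Vec ℕ k) → ∑[ j < k ] (ι (suc (g j)) * ι (lookup α j)) ≡ ι (weightBy g α)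
∑-ι-weightBy g []      = refl
∑-ι-weightBy g (a ∷ α) = trans (cong₂ _+_ (sym (ι-* (suc (g zero)) a)) (∑-ι-weightBy (λ i → g (suc i)) α))
                               (sym (ι-+ (suc (g zero) ℕ.* a) (weightBy (λ i → g (suc i)) α)))

∑-lookup≡Σ1≤-tc : ∀ {k} (t : Vec ℚ k) (y : ℕ → ℚ) → ∑[ j < k ] (lookup t j * y (suc (toℕ j))) ≡ Σ1≤ k (λ c → tc t c * y c)
∑-lookup≡Σ1≤-tc []              y = refl
∑-lookup≡Σ1≤-tc {suc k} (x ∷ t) y = begin
  x * y 1 + ∑[ j < k ] (lookup t j * y (suc (suc (toℕ j))))  ≡⟨ cong (λ s → x * y 1 + s) (∑-lookup≡Σ1≤-tc t (λ c → y (suc c))) ⟩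
  x * y 1 + Σ1≤ k (λ c → tc t c * y (suc c))              ≡⟨ cong (λ s → x * y 1 + s) (Σ1≤-cong k (λ _ → refl)) ⟩
  x * y 1 + Σ1≤ k (λ c → tc (x ∷ t) (suc c) * y (suc c))  ≡⟨ Σ1≤-head k _ ⟨
  Σ1≤ (suc k) (λ c → tc (x ∷ t) c * y c)                   ∎
  where
  Σ1≤-head : ∀ n (f : ℕ → ℚ) → Σ1≤ (suc n) f ≡ f 1 + Σ1≤ n (λ j → f (suc j))
  Σ1≤-head zero    f = trans (ℚP.+-identityˡ (f 1)) (sym (ℚP.+-identityʳ (f 1)))
  Σ1≤-head (suc n) f = trans (cong (_+ f (suc (suc n))) (Σ1≤-head n f)) (ℚP.+-assoc (f 1) _ _)

weightBy-suc⇒sum-suc : ∀ {k} (g : Fin k → ℕ) (α : Vec ℕ k) {n} → weightBy g α ≡ suc n → Σ ℕ (λ s → V.sum α ≡ suc s)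
weightBy-suc⇒sum-suc g (suc a ∷ β) _ = a ℕ.+ V.sum β , refl
weightBy-suc⇒sum-suc g (zero  ∷ β) w≡ =
  weightBy-suc⇒sum-suc (λ i → g (suc i)) β (trans (cong (ℕ._+ weightBy (λ i → g (suc i)) β) (sym (ℕP.*-zeroʳ (suc (g zero))))) w≡)

multiTerm-recurrence : ∀ {k} (t : Vec ℚ k) α {s} → V.sum α ≡ suc s → multiTerm t α ≡ ∑[ j < k ] stepTerm t j α
multiTerm-recurrence {k} t α {s} |α|≡1+s = *-cancelʳ-ι _ _ s (begin
  multiTerm t α * ι (suc s)                           ≡⟨ cong (λ n → multiTerm t α * ι n) |α|≡1+s ⟨
  multiTerm t α * ι (V.sum α)                         ≡⟨ ℚP.*-comm (multiTerm t α) _ ⟩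
  ι (V.sum α) * multiTerm t α                         ≡⟨ cong (_* multiTerm t α) (∑-ι-lookup α) ⟨
  (∑[ j < k ] ι (lookup α j)) * multiTerm t α          ≡⟨ *-distribʳ-sum (multiTerm t α) (λ j → ι (lookup α j)) ⟩
  ∑[ j < k ] (ι (lookup α j) * multiTerm t α)          ≡⟨ sum-cong-≗ (λ j → stepTerm*size t j α) ⟨
  ∑[ j < k ] (stepTerm t j α * ι (V.sum α))            ≡⟨ *-distribʳ-sum (ι (V.sum α)) (λ j → stepTerm t j α) ⟨
  (∑[ j < k ] stepTerm t j α) * ι (V.sum α)            ≡⟨ cong (λ n → (∑[ j < k ] stepTerm t j α) * ι n) |α|≡1+s ⟩
  (∑[ j < k ] stepTerm t j α) * ι (suc s)              ∎)

weight*multiTerm : ∀ {k} (t : Vec ℚ k) α →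
  ι (weight α) * multiTerm t α ≡ ι (V.sum α) * ∑[ j < k ] (ι (suc (toℕ j)) * stepTerm t j α)
weight*multiTerm {k} t α = sym (begin
  ι (V.sum α) * ∑[ j < k ] (ι (suc (toℕ j)) * stepTerm t j α)  ≡⟨ *-distribˡ-sum (ι (V.sum α)) (λ j → ι (suc (toℕ j)) * stepTerm t j α) ⟩
  ∑[ j < k ] (ι (V.sum α) * (ι (suc (toℕ j)) * stepTerm t j α)) ≡⟨ sum-cong-≗ per-index ⟩
  ∑[ j < k ] (ι (suc (toℕ j)) * ι (lookup α j) * multiTerm t α) ≡⟨ *-distribʳ-sum (multiTerm t α) (λ j → ι (suc (toℕ j)) * ι (lookup α j)) ⟨
  (∑[ j < k ] (ι (suc (toℕ j)) * ι (lookup α j))) * multiTerm t α ≡⟨ cong (_* multiTerm t α) (∑-ι-weightBy toℕ α) ⟩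
  ι (weight α) * multiTerm t α                                 ∎)
  where
  rotate : ∀ a b c → a * (b * c) ≡ b * (c * a)
  rotate = solve-∀ ℚ-ring
  per-index : ∀ j → ι (V.sum α) * (ι (suc (toℕ j)) * stepTerm t j α) ≡ ι (suc (toℕ j)) * ι (lookup α j) * multiTerm t α
  per-index j = begin
    ι (V.sum α) * (ι (suc (toℕ j)) * stepTerm t j α)  ≡⟨ rotate (ι (V.sum α)) (ι (suc (toℕ j))) (stepTerm t j α) ⟩
    ι (suc (toℕ j)) * (stepTerm t j α * ι (V.sum α))  ≡⟨ cong (ι (suc (toℕ j)) *_) (stepTerm*size t j α) ⟩
    ι (suc (toℕ j)) * (ι (lookup α j) * multiTerm t α) ≡⟨ ℚP.*-assoc (ι (suc (toℕ j))) (ι (lookup α j)) (multiTerm t α) ⟨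
    ι (suc (toℕ j)) * ι (lookup α j) * multiTerm t α  ∎

laggedTerm : ∀ {k} → Vec ℚ k → ℕ → Fin k → Vec ℕ k → ℚ
laggedTerm t n j β = 𝟙[ weight β ℕ.+ suc (toℕ j) ≡ n ] * (lookup t j * multiTerm t β)

shiftDown-laggedTerm : ∀ {k} (t : Vec ℚ k) n (j : Fin k) α →
  shiftDown j (laggedTerm t n j) α ≡ 𝟙[ weight α ≡ n ] * stepTerm t j α
shiftDown-laggedTerm t n j α =
  trans (shiftDown-weightBy toℕ j (λ w β → 𝟙[ w ≡ n ] * (lookup t j * multiTerm t β)) α)
        (shiftDown-*ˡ j 𝟙[ weight α ≡ n ] _ α)

laggedTerm-support : ∀ {k} (t : Vec ℚ k) n (j : Fin k) β → ¬ All (_≤ n) β → laggedTerm t (suc n) j β ≡ 0ℚ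
laggedTerm-support t n j β β≰n = trans (cong (_* (lookup t j * multiTerm t β)) (𝟙[≡]-no weight≢)) (ℚP.*-zeroˡ (lookup t j * multiTerm t β))
  where
  weight≢ : weight β ℕ.+ suc (toℕ j) ≢ suc n
  weight≢ eq = β≰n (All.map (λ b≤w → ℕP.≤-trans b≤w w≤n) (≤-weightBy toℕ β))
    where
    w≤n : weight β ≤ n
    w≤n = ℕP.≤-pred (ℕP.≤-trans (ℕP.m<m+n (weight β) (s≤s z≤n)) (ℕP.≤-reflexive eq))

Σbox-laggedTerm : ∀ {k} (t : Vec ℚ k) M n (j : Fin k) →
  Σbox k M (laggedTerm t n j) ≡ lookup t j * Σbox k M (λ β → 𝟙[ weight β ℕ.+ suc (toℕ j) ≡ n ] * multiTerm t β)
Σbox-laggedTerm {k} t M n j = trans (ΣL-cong (boxes k M) (λ β → swap 𝟙[ weight β ℕ.+ suc (toℕ j) ≡ n ] (lookup t j) (multiTerm t β)))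
                                    (sym (*-distribˡ-ΣL (boxes k M) (lookup t j) _))
  where
  swap : ∀ a b c → a * (b * c) ≡ b * (a * c)
  swap = solve-∀ ℚ-ring

𝟙*multiTerm≡∑shiftDown : ∀ {k} (t : Vec ℚ k) n α →
  𝟙[ weight α ≡ suc n ] * multiTerm t α ≡ ∑[ j < k ] shiftDown j (laggedTerm t (suc n) j) α
𝟙*multiTerm≡∑shiftDown {k} t n α = begin
  𝟙[ weight α ≡ suc n ] * multiTerm t α                   ≡⟨ 𝟙[≡]*-cong (weight α) (suc n) recurrence ⟩
  𝟙[ weight α ≡ suc n ] * ∑[ j < k ] stepTerm t j α       ≡⟨ *-distribˡ-sum 𝟙[ weight α ≡ suc n ] (λ j → stepTerm t j α) ⟩
  ∑[ j < k ] (𝟙[ weight α ≡ suc n ] * stepTerm t j α)     ≡⟨ sum-cong-≗ (λ j → shiftDown-laggedTerm t (suc n) j α) ⟨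
  ∑[ j < k ] shiftDown j (laggedTerm t (suc n) j) α       ∎
  where
  recurrence : weight α ≡ suc n → multiTerm t α ≡ ∑[ j < k ] stepTerm t j α
  recurrence w≡ = multiTerm-recurrence t α (proj₂ (weightBy-suc⇒sum-suc toℕ α w≡))

lucasTerm : ∀ {k} → Vec ℚ k → ℕ → Vec ℕ k → ℚ
lucasTerm t n α = ratio n (V.sum α) * multinomial α * tpow t α

𝟙*lucasTerm≡∑shiftDown : ∀ {k} (t : Vec ℚ k) n α →
  𝟙[ weight α ≡ suc n ] * lucasTerm t (suc n) α ≡ ∑[ j < k ] (ι (suc (toℕ j)) * shiftDown j (laggedTerm t (suc n) j) α)
𝟙*lucasTerm≡∑shiftDown {k} t n α = begin
  𝟙[ weight α ≡ suc n ] * lucasTerm t (suc n) α                         ≡⟨ 𝟙[≡]*-cong (weight α) (suc n) lucas≡ ⟩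
  𝟙[ weight α ≡ suc n ] * X                                            ≡⟨ *-distribˡ-sum 𝟙[ weight α ≡ suc n ] (λ j → ι (suc (toℕ j)) * stepTerm t j α) ⟩
  ∑[ j < k ] (𝟙[ weight α ≡ suc n ] * (ι (suc (toℕ j)) * stepTerm t j α)) ≡⟨ sum-cong-≗ per-index ⟩
  ∑[ j < k ] (ι (suc (toℕ j)) * shiftDown j (laggedTerm t (suc n) j) α)  ∎
  where
  X : ℚ
  X = ∑[ j < k ] (ι (suc (toℕ j)) * stepTerm t j α)
  swap : ∀ a b c → a * (b * c) ≡ b * (a * c)
  swap = solve-∀ ℚ-ring
  per-index : ∀ j → 𝟙[ weight α ≡ suc n ] * (ι (suc (toℕ j)) * stepTerm t j α) ≡ ι (suc (toℕ j)) * shiftDown j (laggedTerm t (suc n) j) α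
  per-index j = trans (swap 𝟙[ weight α ≡ suc n ] (ι (suc (toℕ j))) (stepTerm t j α)) (cong (ι (suc (toℕ j)) *_) (sym (shiftDown-laggedTerm t (suc n) j α)))
  lucas≡ : weight α ≡ suc n → lucasTerm t (suc n) α ≡ X
  lucas≡ w≡ with weightBy-suc⇒sum-suc toℕ α w≡
  ... | s , |α|≡1+s = begin
    ratio (suc n) (V.sum α) * multinomial α * tpow t α   ≡⟨ cong (λ m → ratio (suc n) m * multinomial α * tpow t α) |α|≡1+s ⟩
    (+ suc n / suc s) * multinomial α * tpow t α        ≡⟨ cong (λ q → q * multinomial α * tpow t α) (n/d≡ι[n]*1/d (suc n) s) ⟩
    ι (suc n) * r * multinomial α * tpow t α            ≡⟨ regroup (ι (suc n)) r (multinomial α) (tpow t α) ⟩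
    r * (ι (suc n) * multiTerm t α)                     ≡⟨ cong (λ m → r * (ι m * multiTerm t α)) w≡ ⟨
    r * (ι (weight α) * multiTerm t α)                  ≡⟨ cong (r *_) (weight*multiTerm t α) ⟩
    r * (ι (V.sum α) * X)                               ≡⟨ cong (λ m → r * (ι m * X)) |α|≡1+s ⟩
    r * (ι (suc s) * X)                                 ≡⟨ ℚP.*-assoc r (ι (suc s)) X ⟨
    (r * ι (suc s)) * X                                 ≡⟨ cong (_* X) (1/n*ι[n]≡1 s) ⟩
    1ℚ * X                                              ≡⟨ ℚP.*-identityˡ X ⟩
    X                                                   ∎
    where
    r : ℚ
    r = + 1 / suc s
    regroup : ∀ n r m p → n * r * m * p ≡ r * (n * (m * p))
    regroup = solve-∀ ℚ-ring

multiSum : ∀ {k} → Vec ℚ k → ℕ → ℕ → ℚ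
multiSum {k} t M n = Σbox k M (λ α → 𝟙[ weight α ≡ n ] * multiTerm t α)

multiTerm-zero : ∀ {k} (t : Vec ℚ k) → multiTerm t (V.replicate k 0) ≡ 1ℚ
multiTerm-zero []      = refl
multiTerm-zero (x ∷ t) = trans (multiTermFrom-∷ 0 x t 0 (V.replicate _ 0))
                               (trans (ℚP.*-identityˡ _) (multiTerm-zero t))

multiSum-lagged : ∀ {k} (t : Vec ℚ k) M n c → (∀ {m} → m < n → multiSum t M m ≡ F t m) →
  Σbox k M (λ β → 𝟙[ weight β ℕ.+ suc c ≡ n ] * multiTerm t β) ≡ nth (Fhist t n) (suc c)
multiSum-lagged {k} t M n c multiSum≡F-below with suc c ℕ.≤? n
... | yes c<n = begin
  Σbox k M (λ β → 𝟙[ weight β ℕ.+ suc c ≡ n ] * multiTerm t β)  ≡⟨ ΣL-cong (boxes k M) (λ β → cong (_* multiTerm t β) (𝟙[≡]-cong (to β) (from β))) ⟩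
  multiSum t M (n ℕ.∸ suc c)                                     ≡⟨ multiSum≡F-below (ℕP.∸-monoʳ-< {o = 0} (s≤s z≤n) c<n) ⟩
  F t (n ℕ.∸ suc c)                                              ≡⟨ nth-Fhist-≤ t n (suc c) c<n ⟨
  nth (Fhist t n) (suc c)                                        ∎
  where
  to : ∀ β → weight β ℕ.+ suc c ≡ n → weight β ≡ n ℕ.∸ suc c
  to β eq = trans (sym (ℕP.m+n∸n≡m (weight β) (suc c))) (cong (ℕ._∸ suc c) eq)
  from : ∀ β → weight β ≡ n ℕ.∸ suc c → weight β ℕ.+ suc c ≡ n
  from β eq = trans (cong (ℕ._+ suc c) eq) (ℕP.m∸n+n≡m c<n)
... | no c≮n = trans (ΣL-zero (boxes k M) (λ β → trans (cong (_* multiTerm t β) (𝟙[≡]-no (≢n β))) (ℚP.*-zeroˡ (multiTerm t β))))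
                     (sym (nth-Fhist-> t n (suc c) (ℕP.≰⇒> c≮n)))
  where
  ≢n : ∀ β → weight β ℕ.+ suc c ≢ n
  ≢n β eq = c≮n (ℕP.≤-trans (ℕP.m≤n+m (suc c) (weight β)) (ℕP.≤-reflexive eq))

multiSum≡F : ∀ {k} (t : Vec ℚ k) M n → n ≤ M → multiSum t M n ≡ F t n
multiSum≡F {k} t M = <-rec (λ n → n ≤ M → multiSum t M n ≡ F t n) step
  where
  step : ∀ n → (∀ {m} → m < n → m ≤ M → multiSum t M m ≡ F t m) → n ≤ M → multiSum t M n ≡ F t n
  step zero    _  _   = trans (Σbox-weight≡0 k M toℕ (multiTerm t)) (multiTerm-zero t)
  step (suc n) ih n<M = begin
    multiSum t M (suc n)
      ≡⟨ ΣL-cong (boxes k M) (𝟙*multiTerm≡∑shiftDown t n) ⟩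
    Σbox k M (λ α → ∑[ j < k ] shiftDown j (laggedTerm t (suc n) j) α)
      ≡⟨ ΣL-sum (boxes k M) (λ j → shiftDown j (laggedTerm t (suc n) j)) ⟩
    ∑[ j < k ] Σbox k M (shiftDown j (laggedTerm t (suc n) j))
      ≡⟨ sum-cong-≗ (λ j → Σbox-shiftDown j M n (laggedTerm t (suc n) j) n<M (laggedTerm-support t n j)) ⟩
    ∑[ j < k ] Σbox k M (laggedTerm t (suc n) j)
      ≡⟨ sum-cong-≗ (λ j → trans (Σbox-laggedTerm t M (suc n) j) (cong (lookup t j *_) (multiSum-lagged t M (suc n) (toℕ j) ih′))) ⟩
    ∑[ j < k ] (lookup t j * nth (Fhist t (suc n)) (suc (toℕ j)))
      ≡⟨ ∑-lookup≡Σ1≤-tc t (nth (Fhist t (suc n))) ⟩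
    Σ1≤ k (λ c → tc t c * nth (Fhist t (suc n)) c)
      ≡⟨ Σ1≤-cong k (λ _ → refl) ⟩
    F t (suc n) ∎
    where
    ih′ : ∀ {m} → m < suc n → multiSum t M m ≡ F t m
    ih′ m<1+n = ih m<1+n (ℕP.≤-trans (ℕP.≤-pred m<1+n) (ℕP.<⇒≤ n<M))

G-expansion : ∀ {k} (t : Vec ℚ k) n →
  G t (suc n) ≡ ∑[ j < k ] (ι (suc (toℕ j)) * (lookup t j * nth (Fhist t (suc n)) (suc (toℕ j))))
G-expansion {k} t n = begin
  G t (suc n)
    ≡⟨ ΣL-filter (λ α → weight α ℕ.≟ suc n) (boxes k (suc n)) (lucasTerm t (suc n)) ⟩
  Σbox k (suc n) (λ α → 𝟙[ weight α ≡ suc n ] * lucasTerm t (suc n) α)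
    ≡⟨ ΣL-cong (boxes k (suc n)) (𝟙*lucasTerm≡∑shiftDown t n) ⟩
  Σbox k (suc n) (λ α → ∑[ j < k ] (ι (suc (toℕ j)) * shiftDown j (laggedTerm t (suc n) j) α))
    ≡⟨ ΣL-sum (boxes k (suc n)) (λ j α → ι (suc (toℕ j)) * shiftDown j (laggedTerm t (suc n) j) α) ⟩
  ∑[ j < k ] Σbox k (suc n) (λ α → ι (suc (toℕ j)) * shiftDown j (laggedTerm t (suc n) j) α)
    ≡⟨ sum-cong-≗ (λ j → trans (sym (*-distribˡ-ΣL (boxes k (suc n)) (ι (suc (toℕ j))) _)) (cong (ι (suc (toℕ j)) *_) (Σbox-lagged j))) ⟩
  ∑[ j < k ] (ι (suc (toℕ j)) * (lookup t j * nth (Fhist t (suc n)) (suc (toℕ j)))) ∎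
  where
  Σbox-lagged : ∀ j → Σbox k (suc n) (shiftDown j (laggedTerm t (suc n) j)) ≡ lookup t j * nth (Fhist t (suc n)) (suc (toℕ j))
  Σbox-lagged j = begin
    Σbox k (suc n) (shiftDown j (laggedTerm t (suc n) j))  ≡⟨ Σbox-shiftDown j (suc n) n _ ℕP.≤-refl (laggedTerm-support t n j) ⟩
    Σbox k (suc n) (laggedTerm t (suc n) j)                ≡⟨ Σbox-laggedTerm t (suc n) (suc n) j ⟩
    lookup t j * Σbox k (suc n) (λ β → 𝟙[ weight β ℕ.+ suc (toℕ j) ≡ suc n ] * multiTerm t β)
                                                           ≡⟨ cong (lookup t j *_) (multiSum-lagged t (suc n) (suc n) (toℕ j)
                                                                 (λ m<1+n → multiSum≡F t (suc n) _ (ℕP.<⇒≤ m<1+n))) ⟩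
    lookup t j * nth (Fhist t (suc n)) (suc (toℕ j))       ∎

G≗F⊛∂tc : ∀ {k} (t : Vec ℚ k) → G t ≗ F t ⊛ ∂ (tc t)
G≗F⊛∂tc t zero    = sym (trans (ℚP.*-identityˡ _) (ℚP.*-zeroˡ 0ℚ))
G≗F⊛∂tc {k} t (suc n) = begin
  G t (suc n)                                                            ≡⟨ G-expansion t n ⟩
  ∑[ j < k ] (ι (suc (toℕ j)) * (lookup t j * y (suc (toℕ j))))          ≡⟨ sum-cong-≗ (λ j → swap (ι (suc (toℕ j))) (lookup t j) _) ⟩
  ∑[ j < k ] (lookup t j * (ι (suc (toℕ j)) * y (suc (toℕ j))))          ≡⟨ ∑-lookup≡Σ1≤-tc t (λ c → ι c * y c) ⟩
  Σ1≤ k (λ c → tc t c * (ι c * y c))                                     ≡⟨ Σ1≤[tc*y]≡Σ≤[y*tc] t (suc n) (λ c → ι c * y c) ι*y-beyond ⟩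
  Σ≤ (suc n) (λ c → ι c * y c * tc t c)                                  ≡⟨ Σ≤-cong (suc n) (λ c _ → shuffle (ι c) (y c) (tc t c)) ⟩
  Σ≤ (suc n) (λ c → y c * ∂ (tc t) c)                                    ≡⟨ Σ≤-Fhist≡⊛ t (suc n) (∂ (tc t)) ⟩
  (F t ⊛ ∂ (tc t)) (suc n)                                               ∎
  where
  y : ℕ → ℚ
  y = nth (Fhist t (suc n))
  ι*y-beyond : ∀ c → suc n < c → ι c * y c ≡ 0ℚ
  ι*y-beyond c n<c = trans (cong (ι c *_) (nth-Fhist-> t (suc n) c n<c)) (ℚP.*-zeroʳ (ι c))
  swap : ∀ a b c → a * (b * c) ≡ b * (a * c)
  swap = solve-∀ ℚ-ring
  shuffle : ∀ a b c → a * b * c ≡ b * (a * c)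
  shuffle = solve-∀ ℚ-ring

isoExp≗F : ∀ {k} (t : Vec ℚ k) → isoExp t ≗ F t
isoExp≗F t zero    = refl
isoExp≗F t (suc n) = begin
  r * Σ1≤ (suc n) (λ i → F t (suc n ℕ.∸ i) * G t i)  ≡⟨ cong (r *_) Σ1≤≡F⊛G ⟩
  r * (F t ⊛ G t) (suc n)                            ≡⟨ cong (r *_) (⊛-congʳ (F t) (G≗F⊛∂tc t) (suc n)) ⟩
  r * (F t ⊛ (F t ⊛ ∂ (tc t))) (suc n)               ≡⟨ cong (r *_) (∂F≗F⊛[F⊛∂τ] (suc n)) ⟨
  r * (ι (suc n) * F t (suc n))                      ≡⟨ ℚP.*-assoc r (ι (suc n)) (F t (suc n)) ⟨
  (r * ι (suc n)) * F t (suc n)                      ≡⟨ cong (_* F t (suc n)) (1/n*ι[n]≡1 n) ⟩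
  1ℚ * F t (suc n)                                   ≡⟨ ℚP.*-identityˡ (F t (suc n)) ⟩
  F t (suc n)                                        ∎
  where
  open Recurrence (F t) (tc t) refl refl (F-recurrence t)
  r : ℚ
  r = + 1 / suc n
  Σ1≤≡F⊛G : Σ1≤ (suc n) (λ i → F t (suc n ℕ.∸ i) * G t i) ≡ (F t ⊛ G t) (suc n)
  Σ1≤≡F⊛G = sym (begin
    (F t ⊛ G t) (suc n)      ≡⟨ Σ≤≡head+Σ1≤ (suc n) _ ⟩
    F t (suc n) * 0ℚ + S     ≡⟨ cong (_+ S) (ℚP.*-zeroʳ (F t (suc n))) ⟩
    0ℚ + S                   ≡⟨ ℚP.+-identityˡ S ⟩
    S                        ∎)
    where
    S : ℚ
    S = Σ1≤ (suc n) (λ i → F t (suc n ℕ.∸ i) * G t i)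

proposition3 : (k : ℕ) → 1 ≤ k → (t : Vec ℚ k) → (Ē : Seq) →
    IsConvInverse (isoExp t) Ē → (n : ℕ) → 1 ≤ n →
    (isoCos (isoExp t) Ē n ≡ ½ * (F t n - tc t n))
    × (isoSin (isoExp t) Ē n ≡ ½ * (F t n + tc t n))
proposition3 k _ t Ē Ē-inverse (suc n) _ =
  trans (cong₂ (λ e ē → ½ * (e + ē)) (isoExp≗F t (suc n)) (Ē≗δ-τ (suc n))) (cos-form ½ (F t (suc n)) (tc t (suc n))) ,
  trans (cong₂ (λ e ē → ½ * (e - ē)) (isoExp≗F t (suc n)) (Ē≗δ-τ (suc n))) (sin-form ½ (F t (suc n)) (tc t (suc n)))
  where
  open Recurrence (F t) (tc t) refl refl (F-recurrence t)
  F⊛Ē≗δ : F t ⊛ Ē ≗ δ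
  F⊛Ē≗δ m = trans (⊛-congˡ Ē (λ i → sym (isoExp≗F t i)) m) (Ē-inverse m)
  Ē≗δ-τ : Ē ≗ λ m → δ m - tc t m
  Ē≗δ-τ = ⊛-inverse-unique (F t) Ē (λ m → δ m - tc t m) F⊛Ē≗δ F⊛[δ-τ]≗δ
  cos-form : ∀ h f τ → h * (f + (0ℚ - τ)) ≡ h * (f - τ)
  cos-form = solve-∀ ℚ-ring
  sin-form : ∀ h f τ → h * (f - (0ℚ - τ)) ≡ h * (f + τ)
  sin-form = solve-∀ ℚ-ring
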